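{- Let $T$ be a tree of order $n\ge 5$. If $T$ is a star, then $\chi_{NL}(T)=n$; otherwise $\chi_{NL}(T)\le n-2$.
   Context: A star is a tree $K_{1,n-1}$ with one vertex adjacent to all others. A $k$-coloring of a graph $G$ is a partition of $V(G)$ into $k$ independent sets (colors). A coloring $\{S_1,\dots,S_k\}$ is neighbor-locating (an NL-coloring) if for any two distinct vertices $u,v$ in the same color class, $\{j: N(u)\cap S_j\neq\emptyset\}\neq\{j: N(v)\cap S_j\neq\emptyset\}$. The neighbor-locating chromatic number $\chi_{NL}(G)$ is the minimum number of colors in an NL-coloring of $G$. -}

module Defs where

open import Data.Nat using (ℕ; zero; suc; _≤_)
open import Data.Fin using (Fin; zero; suc; inject₁; fromℕ)
open import Data.Bool using (Bool; true; false)
open import Data.Product using (Σ; ∃; _×_; _,_)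
open import Data.Sum using (_⊎_)
open import Relation.Nullary using (¬_)
open import Relation.Binary.PropositionalEquality using (_≡_; _≢_)
open import Function.Definitions using (Injective)

record Graph (n : ℕ) : Set where
  field
    adj   : Fin n → Fin n → Bool
    sym   : ∀ u v → adj u v ≡ adj v u
    irrefl : ∀ u → adj u u ≡ false

open Graph public

Adj : ∀ {n} → Graph n → Fin n → Fin n → Set
Adj G u v = adj G u v ≡ true

data Walk {n} (G : Graph n) : Fin n → Fin n → Set where
  here : ∀ {u} → Walk G u u
  step : ∀ {u v w} → Adj G u v → Walk G v w → Walk G u w

Connected : ∀ {n} → Graph n → Set
Connected G = ∀ u v → Walk G u v

-- a cycle of length k+3: distinct vertices f 0, ..., f (k+2), with
-- consecutive vertices adjacent and f (k+2) adjacent to f 0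
record Cycle {n} (G : Graph n) : Set where
  field
    len     : ℕ
    vert    : Fin (suc (suc (suc len))) → Fin n
    inj     : Injective _≡_ _≡_ vert
    consec  : ∀ (i : Fin (suc (suc len))) → Adj G (vert (inject₁ i)) (vert (suc i))
    closing : Adj G (vert (fromℕ (suc (suc len)))) (vert zero)

Acyclic : ∀ {n} → Graph n → Set
Acyclic G = ¬ Cycle G

IsTree : ∀ {n} → Graph n → Set
IsTree G = Connected G × Acyclic G

IsStar : ∀ {n} → Graph n → Set
IsStar {n} G = Σ (Fin n) λ c → ∀ u v →
  (Adj G u v → (u ≡ c × v ≢ c) ⊎ (v ≡ c × u ≢ c)) ×
  ((u ≡ c × v ≢ c) ⊎ (v ≡ c × u ≢ c) → Adj G u v)

-- a k-coloring: a partition of V(G) into k (nonempty) independent sets,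
-- given by a surjective map to Fin k that is proper
record Coloring {n} (G : Graph n) (k : ℕ) : Set where
  field
    col    : Fin n → Fin k
    surj   : ∀ (j : Fin k) → ∃ λ v → col v ≡ j
    proper : ∀ u v → Adj G u v → col u ≢ col v

open Coloring public

NbrColors : ∀ {n k} {G : Graph n} → Coloring G k → Fin n → Fin k → Set
NbrColors {G = G} c u j = ∃ λ w → Adj G u w × col c w ≡ j

IsNL : ∀ {n k} {G : Graph n} → Coloring G k → Set
IsNL {n} {k} c = ∀ (u v : Fin n) → u ≢ v → col c u ≡ col c v →
  ¬ (∀ (j : Fin k) → (NbrColors c u j → NbrColors c v j) × (NbrColors c v j → NbrColors c u j))

HasNLColoring : ∀ {n} → Graph n → ℕ → Set
HasNLColoring G k = Σ (Coloring G k) IsNL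

IsNLChromaticNumber : ∀ {n} → Graph n → ℕ → Set
IsNLChromaticNumber G m = HasNLColoring G m × (∀ k → HasNLColoring G k → m ≤ k)

module Submission where

-- The identity colouring is an NL-colouring of any graph.
-- Conversely, in a star every leaf sees exactly the colour of the centre,
-- so an NL-colouring must give distinct leaves distinct colours, and the
-- centre differs from all leaves since it is adjacent to them: every
-- NL-colouring of a star is injective, hence uses at least n colours.
--
-- A connected graph without a non-backtracking walk
-- a–b–c–d (a P₄) is a star, so a non-star tree contains a P₄.  Since n ≥ 5
-- some vertex lies outside it, and following a walk to that vertex gives an
-- edge leaving the P₄; in a tree this yields either a path P₅ or a
-- "spider" (a vertex of degree three with one leg of length two).  In both
-- configurations we find two disjoint non-adjacent pairs of vertices; the
-- colouring that gives each pair one colour and every other vertex its own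
-- colour uses n − 2 colours, and it is NL because each pair is separated
-- by a colour seen by one of its members but not by the other.

open import Defs hiding (sym)
open import Data.Nat using (ℕ; zero; suc; _≤_; _∸_; s≤s)
open import Data.Nat.Properties using (<⇒≱)
open import Data.Fin using (Fin; zero; suc; punchIn; punchOut) renaming (_≟_ to _≟ᶠ_)
open import Data.Fin.Properties
  using (punchOut-injective; punchOut-cong; punchOut-punchIn; punchInᵢ≢i; injective⇒≤; any?; ¬∀⟶∃¬)
open import Data.Bool using (true) renaming (_≟_ to _≟ᵇ_)
open import Data.Vec using (Vec; []; _∷_; lookup)
open import Data.Vec.Relation.Unary.All using ([]; _∷_)
open import Data.Vec.Relation.Unary.AllPairs using ([]; _∷_)
open import Data.Vec.Relation.Unary.Unique.Propositional using (Unique)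
open import Data.Vec.Relation.Unary.Unique.Propositional.Properties using (lookup-injective)
open import Data.Product using (Σ; ∃; ∃₂; _×_; _,_; proj₁; proj₂)
open import Data.Sum using (_⊎_; inj₁; inj₂)
open import Data.Empty using (⊥; ⊥-elim)
open import Function using (_∘_)
open import Function.Definitions using (Injective)
open import Relation.Nullary using (¬_; Dec; yes; no)
open import Relation.Nullary.Decidable.Core using (_×-dec_; ¬?; decidable-stable)
open import Relation.Binary.PropositionalEquality using (_≡_; _≢_; refl; sym; trans; cong; ≢-sym)

module _ {n} (G : Graph n) where

  adj-sym : ∀ {u v} → Adj G u v → Adj G v u
  adj-sym {u} {v} uv = trans (Graph.sym G v u) uv

  adj⇒≢ : ∀ {u v} → Adj G u v → u ≢ v
  adj⇒≢ {u} uv refl with trans (sym uv) (irrefl G u)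
  ... | ()

  -- adjacency is decidable, which makes P₄-search below a finite check
  adj? : ∀ u v → Dec (Adj G u v)
  adj? u v = adj G u v ≟ᵇ true

  exitEdge : {P : Fin n → Set} → (∀ x → Dec (P x)) → ∀ {s t} → Walk G s t →
    P s → ¬ P t → ∃₂ λ x y → P x × ¬ P y × Adj G x y
  exitEdge P? here Ps ¬Pt = ⊥-elim (¬Pt Ps)
  exitEdge P? (step {v = s′} ss′ walk) Ps ¬Pt with P? s′
  ... | yes Ps′ = exitEdge P? walk Ps′ ¬Pt
  ... | no ¬Ps′ = _ , s′ , Ps , ¬Ps′ , ss′

-- Acyclic graphs have no triangles and no 4-cycles; these are the only
-- cycles the configurations below could close up.

module ShortCycles {n} (G : Graph n) (acyclic : Acyclic G) where

  noTriangle : ∀ {x y z} → Adj G x y → Adj G y z → Adj G z x → ⊥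
  noTriangle {x} {y} {z} xy yz zx = acyclic record
    { len = 0 ; vert = lookup vs ; inj = λ {i} {j} → lookup-injective distinct i j
    ; consec = λ { zero → xy ; (suc zero) → yz } ; closing = zx }
    where
    vs : Vec (Fin n) 3
    vs = x ∷ y ∷ z ∷ []
    distinct : Unique vs
    distinct = (adj⇒≢ G xy ∷ ≢-sym (adj⇒≢ G zx) ∷ [])
             ∷ (adj⇒≢ G yz ∷ []) ∷ [] ∷ []

  -- the two diagonals must be non-degenerate; the sides are distinct anyway
  noSquare : ∀ {x y z t} → x ≢ z → y ≢ t →
    Adj G x y → Adj G y z → Adj G z t → Adj G t x → ⊥
  noSquare {x} {y} {z} {t} x≢z y≢t xy yz zt tx = acyclic record
    { len = 1 ; vert = lookup vs ; inj = λ {i} {j} → lookup-injective distinct i j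
    ; consec = λ { zero → xy ; (suc zero) → yz ; (suc (suc zero)) → zt } ; closing = tx }
    where
    vs : Vec (Fin n) 4
    vs = x ∷ y ∷ z ∷ t ∷ []
    distinct : Unique vs
    distinct = (adj⇒≢ G xy ∷ x≢z ∷ ≢-sym (adj⇒≢ G tx) ∷ [])
             ∷ (adj⇒≢ G yz ∷ y≢t ∷ []) ∷ (adj⇒≢ G zt ∷ []) ∷ [] ∷ []

module _ {n} (G : Graph n) {k} (f : Fin n → Fin k) where

  Sees : Fin n → Fin n → Fin n → Set
  Sees x y w = Adj G x w × (∀ {w′} → f w′ ≡ f w → ¬ Adj G y w′)

  Separated : Fin n → Fin n → Set
  Separated x y = ∃ λ w → Sees x y w ⊎ Sees y x w

SameNbrColors : ∀ {n k} {G : Graph n} → Coloring G k → Fin n → Fin n → Set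
SameNbrColors {k = k} C u v =
  ∀ (j : Fin k) → (NbrColors C u j → NbrColors C v j) × (NbrColors C v j → NbrColors C u j)

module _ {n k} {G : Graph n} (C : Coloring G k) where

  separated⇒differ : ∀ {x y} → Separated G (col C) x y → ¬ SameNbrColors C x y
  separated⇒differ (w , inj₁ (xw , unseen)) same
    with proj₁ (same (col C w)) (w , xw , refl)
  ... | w′ , yw′ , same-colour = unseen same-colour yw′
  separated⇒differ (w , inj₂ (yw , unseen)) same
    with proj₂ (same (col C w)) (w , yw , refl)
  ... | w′ , xw′ , same-colour = unseen same-colour xw′

  separated⇒NL : (∀ u v → u ≢ v → col C u ≡ col C v → Separated G (col C) u v) → IsNL C
  separated⇒NL separated u v u≢v same-colour = separated⇒differ (separated u v u≢v same-colour)

-- Identifying two points: a surjection Fin (suc k) → Fin k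

Pair : ∀ {m} → Fin m → Fin m → Fin m → Fin m → Set
Pair i j x y = (x ≡ i × y ≡ j) ⊎ (x ≡ j × y ≡ i)

module Identify {k} {i j : Fin (suc k)} (i≢j : i ≢ j) where

  -- send j to i, so that the result avoids j and can be punched out
  avoid : Fin (suc k) → Σ (Fin (suc k)) (j ≢_)
  avoid x with x ≟ᶠ j
  ... | yes _ = i , ≢-sym i≢j
  ... | no x≢j = x , ≢-sym x≢j

  avoid-spec : ∀ x → (x ≢ j × proj₁ (avoid x) ≡ x) ⊎ (x ≡ j × proj₁ (avoid x) ≡ i)
  avoid-spec x with x ≟ᶠ j
  ... | yes x≡j = inj₂ (x≡j , refl)
  ... | no x≢j = inj₁ (x≢j , refl)

  identify : Fin (suc k) → Fin k
  identify x = punchOut (proj₂ (avoid x))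

  identify-surjective : ∀ y → ∃ λ x → identify x ≡ y
  identify-surjective y with avoid-spec (punchIn j y)
  ... | inj₁ (_ , same) = punchIn j y , trans (punchOut-cong j same) (punchOut-punchIn j)
  ... | inj₂ (hits-j , _) = ⊥-elim (punchInᵢ≢i j y hits-j)

  identify-fibres : ∀ x y → identify x ≡ identify y → x ≡ y ⊎ Pair i j x y
  identify-fibres x y eq
    with punchOut-injective (proj₂ (avoid x)) (proj₂ (avoid y)) eq | avoid-spec x | avoid-spec y
  ... | same | inj₁ (_ , ax) | inj₁ (_ , ay) = inj₁ (trans (sym ax) (trans same ay))
  ... | same | inj₁ (_ , ax) | inj₂ (y≡j , ay) = inj₂ (inj₁ (trans (sym ax) (trans same ay) , y≡j))
  ... | same | inj₂ (x≡j , ax) | inj₁ (_ , ay) = inj₂ (inj₂ (x≡j , trans (sym ay) (trans (sym same) ax)))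
  ... | _ | inj₂ (x≡j , _) | inj₂ (y≡j , _) = inj₁ (trans x≡j (sym y≡j))

-- Colour classes {p₁, p₂}, {q₁, q₂} and singletons: k colours on k + 2 vertices.
module TwoPairs {k} {p₁ p₂ q₁ q₂ : Fin (suc (suc k))}
  (p₁≢p₂ : p₁ ≢ p₂) (q₁≢q₂ : q₁ ≢ q₂)
  (p₁≢q₁ : p₁ ≢ q₁) (p₁≢q₂ : p₁ ≢ q₂) (p₂≢q₁ : p₂ ≢ q₁) (p₂≢q₂ : p₂ ≢ q₂) where

  private
    module P = Identify p₁≢p₂

    P-apart : ∀ {x q} → q ≢ p₁ → q ≢ p₂ → P.identify x ≡ P.identify q → x ≡ q
    P-apart q≢p₁ q≢p₂ eq with P.identify-fibres _ _ eq
    ... | inj₁ x≡q = x≡q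
    ... | inj₂ (inj₁ (_ , q≡p₂)) = ⊥-elim (q≢p₂ q≡p₂)
    ... | inj₂ (inj₂ (_ , q≡p₁)) = ⊥-elim (q≢p₁ q≡p₁)

    module Q = Identify {i = P.identify q₁} {j = P.identify q₂}
          (q₁≢q₂ ∘ P-apart (≢-sym p₁≢q₂) (≢-sym p₂≢q₂))

  colour : Fin (suc (suc k)) → Fin k
  colour = Q.identify ∘ P.identify

  colour-surjective : ∀ j → ∃ λ x → colour x ≡ j
  colour-surjective j with Q.identify-surjective j
  ... | y , Qy≡j with P.identify-surjective y
  ... | x , Px≡y = x , trans (cong Q.identify Px≡y) Qy≡j

  colour-fibres : ∀ x y → colour x ≡ colour y → x ≡ y ⊎ Pair p₁ p₂ x y ⊎ Pair q₁ q₂ x y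
  colour-fibres x y eq with Q.identify-fibres _ _ eq
  ... | inj₁ Px≡Py with P.identify-fibres x y Px≡Py
  ...   | inj₁ x≡y = inj₁ x≡y
  ...   | inj₂ p-pair = inj₂ (inj₁ p-pair)
  colour-fibres x y eq | inj₂ (inj₁ (x~q₁ , y~q₂)) =
    inj₂ (inj₂ (inj₁ (P-apart (≢-sym p₁≢q₁) (≢-sym p₂≢q₁) x~q₁ , P-apart (≢-sym p₁≢q₂) (≢-sym p₂≢q₂) y~q₂)))
  colour-fibres x y eq | inj₂ (inj₂ (x~q₂ , y~q₁)) =
    inj₂ (inj₂ (inj₂ (P-apart (≢-sym p₁≢q₂) (≢-sym p₂≢q₂) x~q₂ , P-apart (≢-sym p₁≢q₁) (≢-sym p₂≢q₁) y~q₁)))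

  alone : ∀ {w} → w ≢ p₁ → w ≢ p₂ → w ≢ q₁ → w ≢ q₂ → ∀ {w′} → colour w′ ≡ colour w → w′ ≡ w
  alone w≢p₁ w≢p₂ w≢q₁ w≢q₂ eq with colour-fibres _ _ eq
  ... | inj₁ w′≡w = w′≡w
  ... | inj₂ (inj₁ (inj₁ (_ , w≡p₂))) = ⊥-elim (w≢p₂ w≡p₂)
  ... | inj₂ (inj₁ (inj₂ (_ , w≡p₁))) = ⊥-elim (w≢p₁ w≡p₁)
  ... | inj₂ (inj₂ (inj₁ (_ , w≡q₂))) = ⊥-elim (w≢q₂ w≡q₂)
  ... | inj₂ (inj₂ (inj₂ (_ , w≡q₁))) = ⊥-elim (w≢q₁ w≡q₁)

  class-q₂ : ∀ {w′} → colour w′ ≡ colour q₂ → w′ ≡ q₁ ⊎ w′ ≡ q₂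
  class-q₂ eq with colour-fibres _ _ eq
  ... | inj₁ w′≡q₂ = inj₂ w′≡q₂
  ... | inj₂ (inj₁ (inj₁ (_ , q₂≡p₂))) = ⊥-elim (p₂≢q₂ (sym q₂≡p₂))
  ... | inj₂ (inj₁ (inj₂ (_ , q₂≡p₁))) = ⊥-elim (p₁≢q₂ (sym q₂≡p₁))
  ... | inj₂ (inj₂ (inj₁ (w′≡q₁ , _))) = inj₁ w′≡q₁
  ... | inj₂ (inj₂ (inj₂ (w′≡q₂ , _))) = inj₂ w′≡q₂

  twoPairColouring : (T : Graph (suc (suc k))) → ¬ Adj T p₁ p₂ → ¬ Adj T q₁ q₂ →
    Separated T colour p₁ p₂ → Separated T colour q₁ q₂ → HasNLColoring T k
  twoPairColouring T p-nonadj q-nonadj p-sep q-sep = C , separated⇒NL C separated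
    where
    colour-proper : ∀ u v → Adj T u v → colour u ≢ colour v
    colour-proper u v uv eq with colour-fibres u v eq
    ... | inj₁ u≡v = adj⇒≢ T uv u≡v
    ... | inj₂ (inj₁ (inj₁ (refl , refl))) = p-nonadj uv
    ... | inj₂ (inj₁ (inj₂ (refl , refl))) = p-nonadj (adj-sym T uv)
    ... | inj₂ (inj₂ (inj₁ (refl , refl))) = q-nonadj uv
    ... | inj₂ (inj₂ (inj₂ (refl , refl))) = q-nonadj (adj-sym T uv)

    C : Coloring T k
    C = record { col = colour ; surj = colour-surjective ; proper = colour-proper }

    swap : ∀ {x y} → Separated T colour x y → Separated T colour y x
    swap (w , inj₁ sees) = w , inj₂ sees
    swap (w , inj₂ sees) = w , inj₁ sees

    separated : ∀ u v → u ≢ v → colour u ≡ colour v → Separated T colour u v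
    separated u v u≢v eq with colour-fibres u v eq
    ... | inj₁ u≡v = ⊥-elim (u≢v u≡v)
    ... | inj₂ (inj₁ (inj₁ (refl , refl))) = p-sep
    ... | inj₂ (inj₁ (inj₂ (refl , refl))) = swap p-sep
    ... | inj₂ (inj₂ (inj₁ (refl , refl))) = q-sep
    ... | inj₂ (inj₂ (inj₂ (refl , refl))) = swap q-sep

-- The two configurations forced in a non-star tree

module Configurations {k} (T : Graph (suc (suc k))) (acyclic : Acyclic T) where
  open ShortCycles T acyclic

  -- the path v₁ v₂ v₃ v₄ v₅ with classes {v₁, v₄}, {v₂, v₅}: the colour of v₃
  -- is seen from v₄ but not from v₁, and from v₂ but not from v₅
  path₅ : ∀ {v₁ v₂ v₃ v₄ v₅} →
    Adj T v₁ v₂ → Adj T v₂ v₃ → Adj T v₃ v₄ → Adj T v₄ v₅ →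
    v₁ ≢ v₃ → v₂ ≢ v₄ → v₃ ≢ v₅ → HasNLColoring T k
  path₅ {v₁} {v₂} {v₃} {v₄} {v₅} a₁₂ a₂₃ a₃₄ a₄₅ v₁≢v₃ v₂≢v₄ v₃≢v₅ =
    twoPairColouring T (λ a₁₄ → noSquare v₁≢v₃ v₂≢v₄ a₁₂ a₂₃ a₃₄ (adj-sym T a₁₄))
                       (λ a₂₅ → noSquare v₂≢v₄ v₃≢v₅ a₂₃ a₃₄ a₄₅ (adj-sym T a₂₅))
                       (v₃ , inj₂ (adj-sym T a₃₄ , λ eq a₁₃ → noTriangle a₁₂ a₂₃ (adj-sym T (v₃-only eq a₁₃))))
                       (v₃ , inj₁ (a₂₃ , λ eq a₅₃ → noTriangle a₃₄ a₄₅ (v₃-only eq a₅₃)))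
    where
    v₁≢v₄ : v₁ ≢ v₄
    v₁≢v₄ refl = noTriangle a₁₂ a₂₃ a₃₄
    v₂≢v₅ : v₂ ≢ v₅
    v₂≢v₅ refl = noTriangle a₂₃ a₃₄ a₄₅
    v₁≢v₅ : v₁ ≢ v₅
    v₁≢v₅ refl = noSquare v₁≢v₃ v₂≢v₄ a₁₂ a₂₃ a₃₄ a₄₅
    open TwoPairs v₁≢v₄ v₂≢v₅ (adj⇒≢ T a₁₂) v₁≢v₅ (≢-sym v₂≢v₄) (adj⇒≢ T a₄₅)
    v₃-only : ∀ {w′ x} → colour w′ ≡ colour v₃ → Adj T x w′ → Adj T x v₃
    v₃-only {w′} eq xw′ with alone (≢-sym v₁≢v₃) (adj⇒≢ T a₃₄) (≢-sym (adj⇒≢ T a₂₃)) v₃≢v₅ {w′} eq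
    ... | refl = xw′

  -- the spider: B adjacent to A, E and C, and C adjacent to D;
  -- classes {A, C}, {E, D}; D is seen from C only and B from E only
  spider : ∀ {A B C D E} →
    Adj T A B → Adj T E B → Adj T B C → Adj T C D →
    A ≢ C → A ≢ E → C ≢ E → B ≢ D → HasNLColoring T k
  spider {A} {B} {C} {D} {E} ab eb bc cd A≢C A≢E C≢E B≢D =
    twoPairColouring T (λ ac → noTriangle ab bc (adj-sym T ac))
                       (λ ed → noSquare (≢-sym C≢E) B≢D eb bc cd (adj-sym T ed))
                       (D , inj₂ (cd , A-misses-D-class))
                       (B , inj₁ (eb , λ eq db → noTriangle bc cd (B-only eq db)))
    where
    A≢D : A ≢ D
    A≢D refl = noTriangle ab bc cd
    E≢D : E ≢ D
    E≢D refl = noTriangle bc cd eb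
    open TwoPairs A≢C E≢D A≢E A≢D C≢E (adj⇒≢ T cd)
    A-misses-D-class : ∀ {w′} → colour w′ ≡ colour D → ¬ Adj T A w′
    A-misses-D-class {w′} eq with class-q₂ {w′} eq
    ... | inj₁ refl = λ ae → noTriangle ab (adj-sym T eb) (adj-sym T ae)
    ... | inj₂ refl = λ ad → noSquare A≢C B≢D ab bc cd (adj-sym T ad)
    B-only : ∀ {w′ x} → colour w′ ≡ colour B → Adj T x w′ → Adj T x B
    B-only {w′} eq xw′ with alone (≢-sym (adj⇒≢ T ab)) (adj⇒≢ T bc) (≢-sym (adj⇒≢ T eb)) B≢D {w′} eq
    ... | refl = xw′

-- Connected graphs without a P₄ are stars

-- a walk a–b–c–d that never turns back (in a tree: a path on four vertices)
P₄ : ∀ {n} → Graph n → Fin n → Fin n → Fin n → Fin n → Set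
P₄ G a b c d = Adj G a b × Adj G b c × Adj G c d × a ≢ c × b ≢ d

module _ {n} (G : Graph n) where

  p₄? : Dec (∃ λ a → ∃ λ b → ∃ λ c → ∃ λ d → P₄ G a b c d)
  p₄? = any? λ a → any? λ b → any? λ c → any? λ d →
    adj? G a b ×-dec adj? G b c ×-dec adj? G c d ×-dec ¬? (a ≟ᶠ c) ×-dec ¬? (b ≟ᶠ d)

  starAt : Connected G → (c : Fin n) → (∀ {t s} → Adj G c t → Adj G t s → s ≡ c) → IsStar G
  starAt connected c leaves = c , λ u v → edge⇒spoke u v , spoke⇒edge u v
    where
    reach : ∀ {s t} → Walk G s t → s ≡ c ⊎ Adj G c s → t ≡ c ⊎ Adj G c t
    reach here s-near = s-near
    reach (step ss′ walk) (inj₁ refl) = reach walk (inj₂ ss′)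
    reach (step ss′ walk) (inj₂ cs) = reach walk (inj₁ (leaves cs ss′))

    near : ∀ t → t ≡ c ⊎ Adj G c t
    near t = reach (connected c t) (inj₁ refl)

    edge⇒spoke : ∀ u v → Adj G u v → (u ≡ c × v ≢ c) ⊎ (v ≡ c × u ≢ c)
    edge⇒spoke u v uv with u ≟ᶠ c | v ≟ᶠ c
    ... | yes u≡c | yes v≡c = ⊥-elim (adj⇒≢ G uv (trans u≡c (sym v≡c)))
    ... | yes u≡c | no v≢c = inj₁ (u≡c , v≢c)
    ... | no u≢c | yes v≡c = inj₂ (v≡c , u≢c)
    ... | no u≢c | no v≢c with near u
    ...   | inj₁ u≡c = ⊥-elim (u≢c u≡c)
    ...   | inj₂ cu = ⊥-elim (v≢c (leaves cu uv))

    spoke⇒edge : ∀ u v → (u ≡ c × v ≢ c) ⊎ (v ≡ c × u ≢ c) → Adj G u v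
    spoke⇒edge u v (inj₁ (refl , v≢c)) with near v
    ... | inj₁ v≡c = ⊥-elim (v≢c v≡c)
    ... | inj₂ cv = cv
    spoke⇒edge u v (inj₂ (refl , u≢c)) with near u
    ... | inj₁ u≡c = ⊥-elim (u≢c u≡c)
    ... | inj₂ cu = adj-sym G cu

module _ {k} (G : Graph (suc (suc k))) (connected : Connected G) where

  -- take an edge 0–v; if 0 has a second neighbour it is the centre, else v is
  noP₄⇒star : (∀ a b c d → ¬ P₄ G a b c d) → IsStar G
  noP₄⇒star noP₄ with connected zero (suc zero)
  ... | step {v = v} 0v _ with any? (λ w → adj? G zero w ×-dec ¬? (w ≟ᶠ v))
  ...   | yes (w , 0w , w≢v) = starAt G connected zero λ {t} {s} 0t ts →
          decidable-stable (s ≟ᶠ zero) λ s≢0 → case₀ t s 0t ts (≢-sym s≢0)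
    where
    case₀ : ∀ t s → Adj G zero t → Adj G t s → zero ≢ s → ⊥
    case₀ t s 0t ts 0≢s with t ≟ᶠ v
    ... | yes refl = noP₄ w zero t s (adj-sym G 0w , 0t , ts , w≢v , 0≢s)
    ... | no t≢v = noP₄ v zero t s (adj-sym G 0v , 0t , ts , ≢-sym t≢v , 0≢s)
  ...   | no only-v = starAt G connected v λ {t} {s} vt ts →
          decidable-stable (s ≟ᶠ v) λ s≢v → caseᵥ t s vt ts s≢v
    where
    caseᵥ : ∀ t s → Adj G v t → Adj G t s → s ≢ v → ⊥
    caseᵥ t s vt ts s≢v with t ≟ᶠ zero
    ... | yes refl = only-v (s , ts , s≢v)
    ... | no t≢0 = noP₄ zero v t s (0v , vt , ts , ≢-sym t≢0 , ≢-sym s≢v)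

missedPoint : ∀ {m N} (g : Fin m → Fin N) → suc m ≤ N → ∃ λ y → ∀ i → g i ≢ y
missedPoint {m} {N} g m<N with ¬∀⟶∃¬ N (λ y → ∃ λ i → g i ≡ y) (λ y → any? λ i → g i ≟ᶠ y) covers
  where
  covers : ¬ (∀ y → ∃ λ i → g i ≡ y)
  covers hit = <⇒≱ m<N (injective⇒≤ {f = proj₁ ∘ hit} λ {x} {y} eq →
    trans (sym (proj₂ (hit x))) (trans (cong g eq) (proj₂ (hit y))))
... | y , missed = y , λ i gi≡y → missed (i , gi≡y)

module _ {k} (T : Graph (suc (suc k))) (connected : Connected T) (acyclic : Acyclic T)
  (five : 5 ≤ suc (suc k)) where
  open Configurations T acyclic

  -- an edge leaving a P₄ extends it to a P₅ (at an end) or a spider (in the middle)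
  p₄⇒NLColouring : ∀ {a b c d} → P₄ T a b c d → HasNLColoring T k
  p₄⇒NLColouring {a} {b} {c} {d} (ab , bc , cd , a≢c , b≢d) = extend (missedPoint (lookup vs) five)
    where
    vs : Vec (Fin (suc (suc k))) 4
    vs = a ∷ b ∷ c ∷ d ∷ []

    attach : ∀ i {y} → Adj T (lookup vs i) y → (∀ j → lookup vs j ≢ y) → HasNLColoring T k
    attach zero ay y≢ = path₅ (adj-sym T ay) ab bc cd (≢-sym (y≢ (suc zero))) a≢c b≢d
    attach (suc zero) by y≢ = spider ab (adj-sym T by) bc cd a≢c (y≢ zero) (y≢ (suc (suc zero))) b≢d
    attach (suc (suc zero)) cy y≢ =
      spider (adj-sym T cd) (adj-sym T cy) (adj-sym T bc) (adj-sym T ab)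
             (≢-sym b≢d) (y≢ (suc (suc (suc zero)))) (y≢ (suc zero)) (≢-sym a≢c)
    attach (suc (suc (suc zero))) dy y≢ = path₅ ab bc cd dy a≢c b≢d (y≢ (suc (suc zero)))

    extend : (∃ λ z → ∀ i → lookup vs i ≢ z) → HasNLColoring T k
    extend (z , z-missed)
      with exitEdge T (λ x → any? λ i → lookup vs i ≟ᶠ x) (connected a z)
                      (zero , refl) (λ (i , eq) → z-missed i eq)
    ... | _ , y , (i , refl) , y-out , xy = attach i xy (λ j eq → y-out (j , eq))

  nonStar⇒NLColouring : ¬ IsStar T → HasNLColoring T k
  nonStar⇒NLColouring notStar with p₄? T
  ... | yes (_ , _ , _ , _ , path) = p₄⇒NLColouring path
  ... | no noPath = ⊥-elim (notStar (noP₄⇒star T connected λ a b c d path → noPath (a , b , c , d , path)))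

module _ {n} (G : Graph n) where

  identityColouring : Coloring G n
  identityColouring = record { col = λ x → x ; surj = λ j → j , refl ; proper = λ u v → adj⇒≢ G }

  identity-NL : IsNL identityColouring
  identity-NL u v u≢v u≡v _ = u≢v u≡v

  -- leaves of a star see only the colour of the centre, so equal-coloured
  -- vertices of an NL-colouring coincide
  star-NL-injective : IsStar G → ∀ {k} (C : Coloring G k) → IsNL C → Injective _≡_ _≡_ (col C)
  star-NL-injective (c , spokes) C nl {u} {v} eq with u ≟ᶠ v | u ≟ᶠ c | v ≟ᶠ c
  ... | yes u≡v | _ | _ = u≡v
  ... | no u≢v | yes u≡c | yes v≡c = ⊥-elim (u≢v (trans u≡c (sym v≡c)))
  ... | no _ | yes u≡c | no v≢c = ⊥-elim (proper C u v (proj₂ (spokes u v) (inj₁ (u≡c , v≢c))) eq)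
  ... | no _ | no u≢c | yes v≡c = ⊥-elim (proper C u v (proj₂ (spokes u v) (inj₂ (v≡c , u≢c))) eq)
  ... | no u≢v | no u≢c | no v≢c =
    ⊥-elim (nl u v u≢v eq λ j → leaf-colours u v u≢c v≢c j , leaf-colours v u v≢c u≢c j)
    where
    leaf-colours : ∀ x y → x ≢ c → y ≢ c → ∀ j → NbrColors C x j → NbrColors C y j
    leaf-colours x y x≢c y≢c j (w , xw , w-colour) with proj₁ (spokes x w) xw
    ... | inj₁ (x≡c , _) = ⊥-elim (x≢c x≡c)
    ... | inj₂ (refl , _) = c , proj₂ (spokes y c) (inj₂ (refl , y≢c)) , w-colour

  star⇒χNL : IsStar G → IsNLChromaticNumber G n
  star⇒χNL star = (identityColouring , identity-NL) ,
    λ k (C , nl) → injective⇒≤ (star-NL-injective star C nl)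

proposition27 : (n : ℕ) → 5 ≤ n → (T : Graph n) → IsTree T →
    (IsStar T → IsNLChromaticNumber T n) ×
    (¬ IsStar T → ∀ m → IsNLChromaticNumber T m → m ≤ n ∸ 2)
proposition27 zero () T tree
proposition27 (suc zero) (s≤s ()) T tree
proposition27 (suc (suc k)) five T (connected , acyclic) = star⇒χNL T , nonStarCase
  where
  nonStarCase : ¬ IsStar T → ∀ m → IsNLChromaticNumber T m → m ≤ k
  nonStarCase notStar m (_ , minimal) =
    minimal k (nonStar⇒NLColouring T connected acyclic five notStar)
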